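{- For $n\ge1$ let $d_{n,3}(q):=\sum_{w\in\mathcal F_{n,2}}q^{\deg_3(G(w))}$. Then for all $n\ge3$, $$d_{n,3}(q)=q^2\bigl(d_{n-1,3}(q)+d_{n-2,3}(q)\bigr),$$ with $d_{1,3}(q)=q^2+1$ and $d_{2,3}(q)=3q^2$. Moreover, for all $n\ge1$, $$d_{n,3}(q)=\sum_{i=0}^{n}\left((1+q^2)q^{2(n-1-i)}\binom{n-i-1}{i}+(2q^2-q^4)q^{2(n-2-i)}\binom{n-i-2}{i}\right).$$
   Context: $\mathcal F_{n,2}$ is the set of binary words $w=w_1\cdots w_n$ with no two consecutive $1$'s. $P(w)$ is the bargraph polyomino formed by the unit squares $[i-1,i]\times[j-1,j]$, $1\le i\le n$, $1\le j\le w_i+1$. $G(w)$ is the graph whose vertices are the corners of the cells of $P(w)$ and whose edges are the cell sides. $\deg_3(G)$ is the number of vertices of degree $3$ in $G$. Binomial coefficients with integer arguments are $0$ whenever the lower index exceeds the upper index or the lower index is negative (e.g. $\binom{ -1}{0}=0$). -}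

module Defs where

open import Data.Bool using (Bool; true; false; _∧_; _∨_; if_then_else_; T)
open import Data.Nat as ℕ using (ℕ; zero; suc; _≤ᵇ_; _≡ᵇ_)
open import Data.Nat.Combinatorics using (_C_)
open import Data.Integer as ℤ using (ℤ; +_; -[1+_])
open import Data.List using (List; []; _∷_; map; concatMap; filter; upTo; foldr; length)
open import Data.Vec using (Vec; []; _∷_)
import Data.Bool.Properties as BoolP

-- A binary word of length n is a Vec Bool n (false = 0, true = 1).
-- All binary words of length n.
allWords : (n : ℕ) → List (Vec Bool n)
allWords zero = [] ∷ []
allWords (suc n) = concatMap (λ w → (false ∷ w) ∷ (true ∷ w) ∷ []) (allWords n)

noTwoOnes : ∀ {n} → Vec Bool n → Bool
noTwoOnes [] = true
noTwoOnes (_ ∷ []) = true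
noTwoOnes (true ∷ true ∷ w) = false
noTwoOnes (_ ∷ b ∷ w) = noTwoOnes (b ∷ w)

F2 : (n : ℕ) → List (Vec Bool n)
F2 n = filter (λ w → T? (noTwoOnes w)) (allWords n)
  where
  open import Relation.Nullary using (Dec)
  T? : (b : Bool) → Dec (T b)
  T? = BoolP.T?

-- Height of column i (1-based) of P(w): w_i + 1; 0 outside 1..n.
height : ∀ {n} → Vec Bool n → ℕ → ℕ
height [] _ = 0
height (_ ∷ _) zero = 0
height (b ∷ _) (suc zero) = if b then 2 else 1
height (_ ∷ w) (suc (suc k)) = height w (suc k)

-- occ w i j : the unit square [i-1,i]×[j-1,j] is a cell of P(w).
occ : ∀ {n} → Vec Bool n → ℕ → ℕ → Bool
occ w i j = (1 ≤ᵇ j) ∧ (j ≤ᵇ height w i)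

-- Horizontal unit segment (x,y)–(x+1,y) is a side of some cell of P(w).
hEdge : ∀ {n} → Vec Bool n → ℕ → ℕ → Bool
hEdge w x y = occ w (suc x) y ∨ occ w (suc x) (suc y)

-- Vertical unit segment (x,y)–(x,y+1) is a side of some cell of P(w).
vEdge : ∀ {n} → Vec Bool n → ℕ → ℕ → Bool
vEdge w x y = occ w x (suc y) ∨ occ w (suc x) (suc y)

b2n : Bool → ℕ
b2n true = 1
b2n false = 0

degree : ∀ {n} → Vec Bool n → ℕ → ℕ → ℕ
degree w x y =
  b2n (hEdge w x y) ℕ.+ left x ℕ.+ b2n (vEdge w x y) ℕ.+ down y
  where
  left : ℕ → ℕ
  left zero = 0
  left (suc x') = b2n (hEdge w x' y)
  down : ℕ → ℕ
  down zero = 0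
  down (suc y') = b2n (vEdge w x y')

-- deg_3(G(w)): number of vertices of degree 3.  All corners of cells of
-- P(w) lie in [0,n]×[0,3] (heights are at most 2), and lattice points that
-- are not corners have degree 0, so counting over this box is exact.
deg3 : ∀ {n} → Vec Bool n → ℕ
deg3 {n} w = length (filter (λ p → proj p) pts)
  where
  open import Data.Product using (_×_; _,_)
  open import Relation.Nullary using (Dec)
  pts : List (ℕ × ℕ)
  pts = concatMap (λ x → map (λ y → (x , y)) (upTo 4)) (upTo (suc n))
  proj : (p : ℕ × ℕ) → Dec (T (degree w (Data.Product.proj₁ p) (Data.Product.proj₂ p) ≡ᵇ 3))
  proj (x , y) = BoolP.T? _

sumℤ : List ℤ → ℤ
sumℤ = foldr ℤ._+_ (+ 0)

d3 : ℕ → ℤ → ℤ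
d3 n q = sumℤ (map (λ w → q ℤ.^ deg3 w) (F2 n))

-- Binomial coefficient with integer upper index (0 if upper index < 0).
binomZ : ℤ → ℕ → ℤ
binomZ (+ m) k = + (m C k)
binomZ -[1+ _ ] _ = + 0

sumTo : ℕ → (ℕ → ℤ) → ℤ
sumTo n f = sumℤ (map f (upTo (suc n)))

-- The degree-3 vertices of G(w) are counted line by line: one on the left
-- (right) boundary when the first (last) column has height 2, and on the line
-- between two columns two of them if the columns have equal height, one
-- otherwise.  Hence q^deg3 is a product of weights attached to consecutive
-- letters, and the generating functions of words starting with 0 resp. 1 obey
-- a 2×2 transfer system whose matrix [[q², q], [q, 0]] has trace q² and
-- determinant -q²; by Cayley–Hamilton every such sequence satisfies
-- x(n+2) = q²(x(n+1) + x(n)).  The closed form is a combination of the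
-- Fibonacci-type polynomials Σᵢ C(m-i, i) q^(2(m-i)), which satisfy the same
-- recurrence by Pascal's rule, so it suffices to compare the first two values.
module Submission where

open import Defs
open import Data.Nat using (ℕ; _≤_; _∸_) renaming (_*_ to _*ℕ_)
open import Data.Integer using (ℤ; +_; _+_; _-_; _*_; _^_)
open import Data.Product using (_×_)
open import Relation.Binary.PropositionalEquality using (_≡_)

open import Data.Bool using (Bool; true; false; if_then_else_; _∧_)
open import Data.Bool.Properties using (T?)
open import Data.Empty using (⊥-elim)
open import Data.Integer using (_⊖_)
import Data.Integer.Properties as ℤ
open import Data.Integer.Tactic.RingSolver using (solve-∀)
open import Data.List using (List; []; _∷_; _++_; map; concatMap; filter; upTo; applyUpTo; length)
open import Data.List.Properties using (map-++; map-cong; map-upTo; map-applyUpTo)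
open import Data.Nat as ℕ using (zero; suc; z≤n; s≤s; _≡ᵇ_)
import Data.Nat.Properties as ℕ
open import Data.Nat.Combinatorics using (_C_; nCk+nC[k+1]≡[n+1]C[k+1])
open import Data.Nat.ListAction using (sum)
open import Data.Nat.ListAction.Properties using (sum-++)
open import Data.Product using (_,_; proj₁; proj₂)
open import Data.Vec using (Vec; []; _∷_)
open import Function using (_∘_)
open import Relation.Binary.PropositionalEquality
  using (refl; sym; trans; cong; cong₂; module ≡-Reasoning)
open import Relation.Nullary using (yes; no)

open ≡-Reasoning

-- Degree-3 vertices, line by line

length-filter-T? : ∀ {A : Set} (p : A → Bool) (xs : List A) →
  length (filter (λ x → T? (p x)) xs) ≡ sum (map (λ x → b2n (p x)) xs)
length-filter-T? p []       = refl
length-filter-T? p (x ∷ xs) with p x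
... | true  = cong suc (length-filter-T? p xs)
... | false = length-filter-T? p xs

sum-map-concatMap : ∀ {A B : Set} (g : B → ℕ) (h : A → List B) (xs : List A) →
  sum (map g (concatMap h xs)) ≡ sum (map (λ x → sum (map g (h x))) xs)
sum-map-concatMap g h []       = refl
sum-map-concatMap g h (x ∷ xs) = begin
  sum (map g (h x ++ concatMap h xs))
    ≡⟨ cong sum (map-++ g (h x) (concatMap h xs)) ⟩
  sum (map g (h x) ++ map g (concatMap h xs))
    ≡⟨ sum-++ (map g (h x)) (map g (concatMap h xs)) ⟩
  sum (map g (h x)) ℕ.+ sum (map g (concatMap h xs))
    ≡⟨ cong (sum (map g (h x)) ℕ.+_) (sum-map-concatMap g h xs) ⟩
  sum (map g (h x)) ℕ.+ sum (map (λ y → sum (map g (h y))) xs) ∎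

deg3At : ∀ {n} → Vec Bool n → ℕ → ℕ
deg3At w x = sum (map (λ y → b2n (degree w x y ≡ᵇ 3)) (upTo 4))

deg3≡sum-deg3At : ∀ {n} (w : Vec Bool n) → deg3 w ≡ sum (applyUpTo (deg3At w) (suc n))
deg3≡sum-deg3At {n} w = begin
  deg3 w
    ≡⟨ length-filter-T? isDeg3 points ⟩
  sum (map (b2n ∘ isDeg3) points)
    ≡⟨ sum-map-concatMap (b2n ∘ isDeg3) column (upTo (suc n)) ⟩
  sum (map (deg3At w) (upTo (suc n)))
    ≡⟨ cong sum (map-upTo (deg3At w) (suc n)) ⟩
  sum (applyUpTo (deg3At w) (suc n)) ∎
  where
  isDeg3 : ℕ × ℕ → Bool
  isDeg3 p = degree w (proj₁ p) (proj₂ p) ≡ᵇ 3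
  column : ℕ → List (ℕ × ℕ)
  column x = map (x ,_) (upTo 4)
  points : List (ℕ × ℕ)
  points = concatMap column (upTo (suc n))

-- Between columns of equal height there is a degree-3 vertex at the bottom and
-- at the top; between heights 1 and 2 the corner of the step has degree 4.
junction : Bool → Bool → ℕ
junction false false = 2
junction true  true  = 2
junction false true  = 1
junction true  false = 1

-- Degree-3 vertices of G(b ∷ w) strictly to the right of the line x = 0.
tailDeg3 : ∀ {n} → Bool → Vec Bool n → ℕ
tailDeg3 b []      = b2n b
tailDeg3 b (c ∷ w) = junction b c ℕ.+ tailDeg3 c w

deg3At-first : ∀ {n} b (w : Vec Bool n) → deg3At (b ∷ w) 0 ≡ b2n b
deg3At-first false w = refl
deg3At-first true  w = refl

deg3At-junction : ∀ {n} b c (w : Vec Bool n) → deg3At (b ∷ c ∷ w) 1 ≡ junction b c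
deg3At-junction false false w = refl
deg3At-junction false true  w = refl
deg3At-junction true  false w = refl
deg3At-junction true  true  w = refl

deg3At-last : ∀ b → deg3At (b ∷ []) 1 ℕ.+ 0 ≡ b2n b
deg3At-last false = refl
deg3At-last true  = refl

-- The recursive call type-checks because deg3At (b ∷ c ∷ w) (2 + k) reduces
-- to deg3At (c ∷ w) (1 + k): a vertex only sees the two columns next to it.
sum-deg3At-tail : ∀ {n} b (w : Vec Bool n) →
  sum (applyUpTo (deg3At (b ∷ w) ∘ suc) (suc n)) ≡ tailDeg3 b w
sum-deg3At-tail b []      = deg3At-last b
sum-deg3At-tail b (c ∷ w) = cong₂ ℕ._+_ (deg3At-junction b c w) (sum-deg3At-tail c w)

deg3-∷ : ∀ {n} b (w : Vec Bool n) → deg3 (b ∷ w) ≡ b2n b ℕ.+ tailDeg3 b w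
deg3-∷ b w = trans (deg3≡sum-deg3At (b ∷ w))
                   (cong₂ ℕ._+_ (deg3At-first b w) (sum-deg3At-tail b w))

-- Sums of integers over lists

sumℤ-map-linear : ∀ {A : Set} (a b : ℤ) (f g : A → ℤ) (xs : List A) →
  sumℤ (map (λ x → a * f x + b * g x) xs) ≡ a * sumℤ (map f xs) + b * sumℤ (map g xs)
sumℤ-map-linear a b f g []       = cong₂ _+_ (sym (ℤ.*-zeroʳ a)) (sym (ℤ.*-zeroʳ b))
sumℤ-map-linear a b f g (x ∷ xs) =
  trans (cong (_+_ (a * f x + b * g x)) (sumℤ-map-linear a b f g xs))
        (interchange a b (f x) (g x) (sumℤ (map f xs)) (sumℤ (map g xs)))
  where
  interchange : ∀ a b u v s t → a * u + b * v + (a * s + b * t) ≡ a * (u + s) + b * (v + t)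
  interchange = solve-∀

sumℤ-map-filter : ∀ {A : Set} (p : A → Bool) (f : A → ℤ) (xs : List A) →
  sumℤ (map f (filter (λ x → T? (p x)) xs)) ≡ sumℤ (map (λ x → if p x then f x else + 0) xs)
sumℤ-map-filter p f []       = refl
sumℤ-map-filter p f (x ∷ xs) with p x
... | true  = cong (_+_ (f x)) (sumℤ-map-filter p f xs)
... | false = trans (sumℤ-map-filter p f xs) (sym (ℤ.+-identityˡ _))

sumℤ-map-pairs : ∀ {A B : Set} (φ : B → ℤ) (f g : A → B) (xs : List A) →
  sumℤ (map φ (concatMap (λ x → f x ∷ g x ∷ []) xs)) ≡ sumℤ (map (λ x → φ (f x) + φ (g x)) xs)
sumℤ-map-pairs φ f g []       = refl
sumℤ-map-pairs φ f g (x ∷ xs) =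
  trans (cong (λ s → φ (f x) + (φ (g x) + s)) (sumℤ-map-pairs φ f g xs))
        (sym (ℤ.+-assoc (φ (f x)) (φ (g x)) _))

sumAllWords-suc : ∀ {n} (a : Bool → ℤ) (φ : Vec Bool (suc n) → ℤ) (ψ : Bool → Vec Bool n → ℤ) →
  (∀ b w → φ (b ∷ w) ≡ a b * ψ b w) →
  sumℤ (map φ (allWords (suc n)))
    ≡ a false * sumℤ (map (ψ false) (allWords n)) + a true * sumℤ (map (ψ true) (allWords n))
sumAllWords-suc {n} a φ ψ split = begin
  sumℤ (map φ (allWords (suc n)))
    ≡⟨ sumℤ-map-pairs φ (false ∷_) (true ∷_) (allWords n) ⟩
  sumℤ (map (λ w → φ (false ∷ w) + φ (true ∷ w)) (allWords n))
    ≡⟨ cong sumℤ (map-cong (λ w → cong₂ _+_ (split false w) (split true w)) (allWords n)) ⟩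
  sumℤ (map (λ w → a false * ψ false w + a true * ψ true w) (allWords n))
    ≡⟨ sumℤ-map-linear (a false) (a true) (ψ false) (ψ true) (allWords n) ⟩
  a false * sumℤ (map (ψ false) (allWords n)) + a true * sumℤ (map (ψ true) (allWords n)) ∎

-- The transfer system

if-^-+ : ∀ (q : ℤ) (c : Bool) m k →
  (if c then q ^ (m ℕ.+ k) else + 0) ≡ q ^ m * (if c then q ^ k else + 0)
if-^-+ q true  m k = ℤ.^-distribˡ-+-* q m k
if-^-+ q false m k = sym (ℤ.*-zeroʳ (q ^ m))

weightFrom : ∀ {n} → ℤ → Bool → Vec Bool n → ℤ
weightFrom q b w = if noTwoOnes (b ∷ w) then q ^ tailDeg3 b w else + 0

transfer : ℤ → Bool → Bool → ℤ
transfer q b c = if b ∧ c then + 0 else q ^ junction b c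

weightFrom-∷ : ∀ {n} q b c (w : Vec Bool n) →
  weightFrom q b (c ∷ w) ≡ transfer q b c * weightFrom q c w
weightFrom-∷ q false false w = if-^-+ q (noTwoOnes (false ∷ w)) 2 (tailDeg3 false w)
weightFrom-∷ q false true  w = if-^-+ q (noTwoOnes (true ∷ w)) 1 (tailDeg3 true w)
weightFrom-∷ q true  false w = if-^-+ q (noTwoOnes (false ∷ w)) 1 (tailDeg3 false w)
weightFrom-∷ q true  true  w = sym (ℤ.*-zeroˡ (weightFrom q true w))

-- Generating function of the words w of length n for which b ∷ w has no two
-- consecutive 1's, counted by tailDeg3 b w.
followGF : ℤ → Bool → ℕ → ℤ
followGF q b n = sumℤ (map (weightFrom q b) (allWords n))

followGF-suc : ∀ q b n →
  followGF q b (suc n) ≡ transfer q b false * followGF q false n + transfer q b true * followGF q true n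
followGF-suc q b n = sumAllWords-suc {n} (transfer q b) (weightFrom q b) (weightFrom q) (weightFrom-∷ q b)

d3-suc : ∀ q n → d3 (suc n) q ≡ q ^ 0 * followGF q false n + q ^ 1 * followGF q true n
d3-suc q n =
  trans (sumℤ-map-filter noTwoOnes (λ w → q ^ deg3 w) (allWords (suc n)))
        (sumAllWords-suc (λ b → q ^ b2n b) _ (weightFrom q) split)
  where
  split : ∀ b (w : Vec Bool n) →
    (if noTwoOnes (b ∷ w) then q ^ deg3 (b ∷ w) else + 0) ≡ q ^ b2n b * weightFrom q b w
  split b w = trans (cong (λ e → if noTwoOnes (b ∷ w) then q ^ e else + 0) (deg3-∷ b w))
                    (if-^-+ q (noTwoOnes (b ∷ w)) (b2n b) (tailDeg3 b w))

-- Second-order recurrences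

Recurrent : ℤ → (ℕ → ℤ) → Set
Recurrent c x = ∀ n → x (suc (suc n)) ≡ c * (x (suc n) + x n)

recurrent-≗ : ∀ {c} {x y : ℕ → ℤ} → (∀ n → x n ≡ y n) → Recurrent c x → Recurrent c y
recurrent-≗ {c} {x} {y} x≗y rx n = begin
  y (suc (suc n))            ≡⟨ sym (x≗y (suc (suc n))) ⟩
  x (suc (suc n))            ≡⟨ rx n ⟩
  c * (x (suc n) + x n)      ≡⟨ cong₂ (λ u v → c * (u + v)) (x≗y (suc n)) (x≗y n) ⟩
  c * (y (suc n) + y n)      ∎

recurrent-linear : ∀ {c} (a b : ℤ) {x y : ℕ → ℤ} → Recurrent c x → Recurrent c y →
  Recurrent c (λ n → a * x n + b * y n)
recurrent-linear {c} a b {x} {y} rx ry n = begin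
  a * x (suc (suc n)) + b * y (suc (suc n))
    ≡⟨ cong₂ (λ u v → a * u + b * v) (rx n) (ry n) ⟩
  a * (c * (x (suc n) + x n)) + b * (c * (y (suc n) + y n))
    ≡⟨ regroup a b c (x (suc n)) (x n) (y (suc n)) (y n) ⟩
  c * ((a * x (suc n) + b * y (suc n)) + (a * x n + b * y n)) ∎
  where
  regroup : ∀ a b c u u′ v v′ →
    a * (c * (u + u′)) + b * (c * (v + v′)) ≡ c * ((a * u + b * v) + (a * u′ + b * v′))
  regroup = solve-∀

recurrent-unique : ∀ {c} {x y : ℕ → ℤ} → Recurrent c x → Recurrent c y →
  x 0 ≡ y 0 → x 1 ≡ y 1 → ∀ n → x n ≡ y n
recurrent-unique {c} {x} {y} rx ry e₀ e₁ n = proj₁ (agree n)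
  where
  agree : ∀ n → x n ≡ y n × x (suc n) ≡ y (suc n)
  agree zero    = e₀ , e₁
  agree (suc n) with agree n
  ... | eₙ , eₙ₊₁ = eₙ₊₁ , trans (rx n) (trans (cong₂ (λ u v → c * (u + v)) eₙ₊₁ eₙ) (sym (ry n)))

-- Cayley–Hamilton for the matrix [[c, p], [p, 0]] with p² = c.
symmetricTransfer-recurrent : ∀ {c p : ℤ} {x y : ℕ → ℤ} → p * p ≡ c →
  (∀ n → x (suc n) ≡ c * x n + p * y n) → (∀ n → y (suc n) ≡ p * x n) →
  Recurrent c x × Recurrent c y
symmetricTransfer-recurrent {c} {p} {x} {y} p²≡c x-suc y-suc = x-rec , y-rec
  where
  x-rec : Recurrent c x
  x-rec n = begin
    x (suc (suc n))                    ≡⟨ x-suc (suc n) ⟩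
    c * x (suc n) + p * y (suc n)      ≡⟨ cong (λ t → c * x (suc n) + p * t) (y-suc n) ⟩
    c * x (suc n) + p * (p * x n)      ≡⟨ cong (_+_ (c * x (suc n))) (sym (ℤ.*-assoc p p (x n))) ⟩
    c * x (suc n) + p * p * x n        ≡⟨ cong (λ t → c * x (suc n) + t * x n) p²≡c ⟩
    c * x (suc n) + c * x n            ≡⟨ sym (ℤ.*-distribˡ-+ c (x (suc n)) (x n)) ⟩
    c * (x (suc n) + x n)              ∎
  regroup : ∀ c p u v → p * (c * u + p * v) ≡ c * (p * u) + p * p * v
  regroup = solve-∀
  y-rec : Recurrent c y
  y-rec n = begin
    y (suc (suc n))                    ≡⟨ y-suc (suc n) ⟩
    p * x (suc n)                      ≡⟨ cong (p *_) (x-suc n) ⟩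
    p * (c * x n + p * y n)            ≡⟨ regroup c p (x n) (y n) ⟩
    c * (p * x n) + p * p * y n        ≡⟨ cong₂ (λ s t → c * s + t * y n) (sym (y-suc n)) p²≡c ⟩
    c * y (suc n) + c * y n            ≡⟨ sym (ℤ.*-distribˡ-+ c (y (suc n)) (y n)) ⟩
    c * (y (suc n) + y n)              ∎

followGF-recurrent : ∀ q →
  Recurrent (q ^ 2) (followGF q false) × Recurrent (q ^ 2) (followGF q true)
followGF-recurrent q =
  symmetricTransfer-recurrent {q ^ 2} {q ^ 1} {followGF q false} {followGF q true}
    (sym (ℤ.^-distribˡ-+-* q 1 1)) (followGF-suc q false) true-suc
  where
  true-suc : ∀ n → followGF q true (suc n) ≡ q ^ 1 * followGF q false n
  true-suc n = trans (followGF-suc q true n) (ℤ.+-identityʳ (q ^ 1 * followGF q false n))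

d3-recurrent : ∀ q → Recurrent (q ^ 2) (λ n → d3 (suc n) q)
d3-recurrent q = recurrent-≗ {q ^ 2} (λ n → sym (d3-suc q n))
  (recurrent-linear {q ^ 2} (q ^ 0) (q ^ 1) {followGF q false} {followGF q true}
    (proj₁ (followGF-recurrent q)) (proj₂ (followGF-recurrent q)))

-- d3 1 q and d3 2 q are computed by normalisation, e.g. d3 1 q = + 1 + (q ^ 2 + + 0).
d3-one : ∀ q → d3 1 q ≡ q ^ 2 + + 1
d3-one q = trans (cong (_+_ (+ 1)) (ℤ.+-identityʳ (q ^ 2))) (ℤ.+-comm (+ 1) (q ^ 2))

d3-two : ∀ q → d3 2 q ≡ + 3 * q ^ 2
d3-two q = triple (q ^ 2)
  where
  triple : ∀ x → x + (x + (x + + 0)) ≡ + 3 * x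
  triple = solve-∀

-- The closed form

Σ< : ℕ → (ℕ → ℤ) → ℤ
Σ< K f = sumℤ (map f (upTo K))

Σ<-suc : ∀ (f : ℕ → ℤ) K → Σ< (suc K) f ≡ f 0 + Σ< K (f ∘ suc)
Σ<-suc f K = cong (λ xs → f 0 + sumℤ xs)
  (trans (map-applyUpTo suc f K) (sym (map-upTo (f ∘ suc) K)))

Σ<-snoc : ∀ (f : ℕ → ℤ) K → Σ< (suc K) f ≡ Σ< K f + f K
Σ<-snoc f zero    = trans (ℤ.+-identityʳ (f 0)) (sym (ℤ.+-identityˡ (f 0)))
Σ<-snoc f (suc K) = begin
  Σ< (suc (suc K)) f                    ≡⟨ Σ<-suc f (suc K) ⟩
  f 0 + Σ< (suc K) (f ∘ suc)            ≡⟨ cong (_+_ (f 0)) (Σ<-snoc (f ∘ suc) K) ⟩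
  f 0 + (Σ< K (f ∘ suc) + f (suc K))    ≡⟨ sym (ℤ.+-assoc (f 0) _ (f (suc K))) ⟩
  f 0 + Σ< K (f ∘ suc) + f (suc K)      ≡⟨ cong (_+ f (suc K)) (sym (Σ<-suc f K)) ⟩
  Σ< (suc K) f + f (suc K)              ∎

Σ<-extend : ∀ (f : ℕ → ℤ) K → (∀ i → K ≤ i → f i ≡ + 0) → ∀ j → Σ< (j ℕ.+ K) f ≡ Σ< K f
Σ<-extend f K vanish zero    = refl
Σ<-extend f K vanish (suc j) = begin
  Σ< (suc (j ℕ.+ K)) f           ≡⟨ Σ<-snoc f (j ℕ.+ K) ⟩
  Σ< (j ℕ.+ K) f + f (j ℕ.+ K)   ≡⟨ cong₂ _+_ (Σ<-extend f K vanish j) (vanish (j ℕ.+ K) (ℕ.m≤n+m K j)) ⟩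
  Σ< K f + + 0                   ≡⟨ ℤ.+-identityʳ (Σ< K f) ⟩
  Σ< K f                         ∎

powBinom : ℤ → ℕ → ℕ → ℤ
powBinom q k i = q ^ (2 *ℕ k) * + (k C i)

^-2*suc : ∀ (q : ℤ) k → q ^ (2 *ℕ suc k) ≡ q ^ 2 * q ^ (2 *ℕ k)
^-2*suc q k = trans (cong (q ^_) (ℕ.*-suc 2 k)) (ℤ.^-distribˡ-+-* q 2 (2 *ℕ k))

powBinom-zero : ∀ q k → powBinom q (suc k) 0 ≡ q ^ 2 * powBinom q k 0
powBinom-zero q k = trans (cong (_* + 1) (^-2*suc q k)) (ℤ.*-assoc (q ^ 2) (q ^ (2 *ℕ k)) (+ 1))

powBinom-pascal : ∀ q k i →
  powBinom q (suc k) (suc i) ≡ q ^ 2 * (powBinom q k i + powBinom q k (suc i))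
powBinom-pascal q k i = begin
  q ^ (2 *ℕ suc k) * + (suc k C suc i)
    ≡⟨ cong₂ _*_ (^-2*suc q k) (cong +_ (sym (nCk+nC[k+1]≡[n+1]C[k+1] k i))) ⟩
  q ^ 2 * q ^ (2 *ℕ k) * + (k C i ℕ.+ k C suc i)
    ≡⟨ cong (q ^ 2 * q ^ (2 *ℕ k) *_) (ℤ.pos-+ (k C i) (k C suc i)) ⟩
  q ^ 2 * q ^ (2 *ℕ k) * (+ (k C i) + + (k C suc i))
    ≡⟨ distribute (q ^ 2) (q ^ (2 *ℕ k)) (+ (k C i)) (+ (k C suc i)) ⟩
  q ^ 2 * (q ^ (2 *ℕ k) * + (k C i) + q ^ (2 *ℕ k) * + (k C suc i)) ∎
  where
  distribute : ∀ x y a b → x * y * (a + b) ≡ x * (y * a + y * b)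
  distribute = solve-∀

fibTerm : ℤ → ℕ → ℕ → ℤ
fibTerm q m i = powBinom q (m ∸ i) i

fibTerm-vanishes : ∀ q {m} i → m ≤ suc i → fibTerm q m (suc i) ≡ + 0
fibTerm-vanishes q i m≤1+i rewrite ℕ.m≤n⇒m∸n≡0 m≤1+i = refl

fibTerm-pascal : ∀ q m i →
  fibTerm q (suc (suc m)) (suc i) ≡ q ^ 2 * (fibTerm q m i + fibTerm q (suc m) (suc i))
fibTerm-pascal q m i with i ℕ.≤? m
... | yes i≤m = trans (cong (λ k → powBinom q k (suc i)) (ℕ.+-∸-assoc 1 i≤m))
                      (powBinom-pascal q (m ∸ i) i)
fibTerm-pascal q m zero    | no i≰m = ⊥-elim (i≰m z≤n)
fibTerm-pascal q m (suc i) | no i≰m = begin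
  fibTerm q (suc (suc m)) (suc (suc i))
    ≡⟨ fibTerm-vanishes q (suc i) (s≤s (s≤s m≤i)) ⟩
  + 0
    ≡⟨ sym (ℤ.*-zeroʳ (q ^ 2)) ⟩
  q ^ 2 * (+ 0 + + 0)
    ≡⟨ cong (λ t → q ^ 2 * t) (sym (cong₂ _+_ (fibTerm-vanishes q i m≤1+i)
                                               (fibTerm-vanishes q (suc i) (s≤s m≤1+i)))) ⟩
  q ^ 2 * (fibTerm q m (suc i) + fibTerm q (suc m) (suc (suc i))) ∎
  where
  m≤i : m ≤ i
  m≤i = ℕ.≤-pred (ℕ.≰⇒> i≰m)
  m≤1+i : m ≤ suc i
  m≤1+i = ℕ.m≤n⇒m≤1+n m≤i

-- Σᵢ C(m-i, i) q^(2(m-i)), the m-th Fibonacci polynomial evaluated at q².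
fibPoly : ℤ → ℕ → ℤ
fibPoly q m = Σ< (suc m) (fibTerm q m)

fibPoly-extend : ∀ q m j → Σ< (j ℕ.+ suc m) (fibTerm q m) ≡ fibPoly q m
fibPoly-extend q m = Σ<-extend (fibTerm q m) (suc m) vanish
  where
  vanish : ∀ i → suc m ≤ i → fibTerm q m i ≡ + 0
  vanish (suc i) (s≤s m≤i) = fibTerm-vanishes q i (ℕ.m≤n⇒m≤1+n m≤i)

fibPoly-one : ∀ q → fibPoly q 1 ≡ q ^ 2
fibPoly-one q = trans (ℤ.+-identityʳ (q ^ 2 * + 1)) (ℤ.*-identityʳ (q ^ 2))

fibPoly-recurrent : ∀ q → Recurrent (q ^ 2) (fibPoly q)
fibPoly-recurrent q m = begin
  fibPoly q (suc (suc m))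
    ≡⟨ Σ<-suc t₂ (suc (suc m)) ⟩
  t₂ 0 + Σ< (suc (suc m)) (t₂ ∘ suc)
    ≡⟨ cong₂ _+_ (powBinom-zero q (suc m))
                 (cong sumℤ (map-cong (fibTerm-pascal q m) range)) ⟩
  c * t₁ 0 + Σ< (suc (suc m)) (λ i → c * (t₀ i + t₁ (suc i)))
    ≡⟨ cong (_+_ (c * t₁ 0)) (trans (cong sumℤ (map-cong (λ i → ℤ.*-distribˡ-+ c (t₀ i) (t₁ (suc i))) range))
                                    (sumℤ-map-linear c c t₀ (t₁ ∘ suc) range)) ⟩
  c * t₁ 0 + (c * Σ< (suc (suc m)) t₀ + c * Σ< (suc (suc m)) (t₁ ∘ suc))
    ≡⟨ regroup c (t₁ 0) (Σ< (suc (suc m)) t₀) (Σ< (suc (suc m)) (t₁ ∘ suc)) ⟩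
  c * (t₁ 0 + Σ< (suc (suc m)) (t₁ ∘ suc) + Σ< (suc (suc m)) t₀)
    ≡⟨ cong (λ s → c * (s + Σ< (suc (suc m)) t₀)) (sym (Σ<-suc t₁ (suc (suc m)))) ⟩
  c * (Σ< (suc (suc (suc m))) t₁ + Σ< (suc (suc m)) t₀)
    ≡⟨ cong₂ (λ s t → c * (s + t)) (fibPoly-extend q (suc m) 1) (fibPoly-extend q m 1) ⟩
  c * (fibPoly q (suc m) + fibPoly q m) ∎
  where
  c : ℤ
  c = q ^ 2
  t₀ t₁ t₂ : ℕ → ℤ
  t₀ = fibTerm q m
  t₁ = fibTerm q (suc m)
  t₂ = fibTerm q (suc (suc m))
  range : List ℕ
  range = upTo (suc (suc m))
  regroup : ∀ c a s t → c * a + (c * s + c * t) ≡ c * (a + t + s)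
  regroup = solve-∀

prevFibPoly : ℤ → ℕ → ℤ
prevFibPoly q zero    = + 0
prevFibPoly q (suc m) = fibPoly q m

prevFibPoly-recurrent : ∀ q → Recurrent (q ^ 2) (prevFibPoly q)
prevFibPoly-recurrent q zero    = trans (fibPoly-one q) (sym (ℤ.*-identityʳ (q ^ 2)))
prevFibPoly-recurrent q (suc m) = fibPoly-recurrent q m

binomZ-⊖ : ∀ m i k → binomZ (m ⊖ suc i) (suc k) ≡ + ((m ∸ suc i) C suc k)
binomZ-⊖ zero    i       k = refl
binomZ-⊖ (suc m) zero    k = cong (λ z → binomZ z (suc k)) (trans (ℤ.[1+m]⊖[1+n]≡m⊖n m 0) (ℤ.⊖-≥ z≤n))
binomZ-⊖ (suc m) (suc i) k = trans (cong (λ z → binomZ z (suc k)) (ℤ.[1+m]⊖[1+n]≡m⊖n m (suc i)))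
                                   (binomZ-⊖ m i k)

binomZ-minus : ∀ m i → binomZ (+ m - + i) i ≡ + ((m ∸ i) C i)
binomZ-minus m zero    = refl
binomZ-minus m (suc i) = binomZ-⊖ m i i

closedTerm : ℤ → ℕ → ℕ → ℤ
closedTerm q n i =
  (+ 1 + q ^ 2) * q ^ (2 *ℕ (n ∸ 1 ∸ i)) * binomZ (+ n - + 1 - + i) i
  + (+ 2 * q ^ 2 - q ^ 4) * q ^ (2 *ℕ (n ∸ 2 ∸ i)) * binomZ (+ n - + 2 - + i) i

closedForm : ℤ → ℕ → ℤ
closedForm q n = sumTo n (closedTerm q n)

prevFibTerm : ℤ → ℕ → ℕ → ℤ
prevFibTerm q zero    i = + 0
prevFibTerm q (suc m) i = fibTerm q m i

Σ<-prevFibTerm : ∀ q m → Σ< (suc (suc m)) (prevFibTerm q m) ≡ prevFibPoly q m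
Σ<-prevFibTerm q zero    = refl
Σ<-prevFibTerm q (suc m) = fibPoly-extend q m 2

closedTerm-fib : ∀ q m i →
  closedTerm q (suc m) i
    ≡ (+ 1 + q ^ 2) * fibTerm q m i + (+ 2 * q ^ 2 - q ^ 4) * prevFibTerm q m i
closedTerm-fib q m i = cong₂ _+_
  (trans (ℤ.*-assoc (+ 1 + q ^ 2) _ _) (cong (λ b → (+ 1 + q ^ 2) * (q ^ (2 *ℕ (m ∸ i)) * b)) (binomZ-minus m i)))
  (second m)
  where
  β : ℤ
  β = + 2 * q ^ 2 - q ^ 4
  binomZ-negative : ∀ i → binomZ (+ 1 - + 2 - + i) i ≡ + 0
  binomZ-negative zero    = refl
  binomZ-negative (suc i) = refl
  second : ∀ m → β * q ^ (2 *ℕ (suc m ∸ 2 ∸ i)) * binomZ (+ suc m - + 2 - + i) i ≡ β * prevFibTerm q m i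
  second zero    = trans (cong (β * q ^ (2 *ℕ (0 ∸ i)) *_) (binomZ-negative i))
                         (trans (ℤ.*-zeroʳ (β * q ^ (2 *ℕ (0 ∸ i)))) (sym (ℤ.*-zeroʳ β)))
  second (suc k) = trans (ℤ.*-assoc β _ _) (cong (λ b → β * (q ^ (2 *ℕ (k ∸ i)) * b)) (binomZ-minus k i))

closedForm-suc : ∀ q m →
  closedForm q (suc m) ≡ (+ 1 + q ^ 2) * fibPoly q m + (+ 2 * q ^ 2 - q ^ 4) * prevFibPoly q m
closedForm-suc q m = begin
  Σ< (suc (suc m)) (closedTerm q (suc m))
    ≡⟨ cong sumℤ (map-cong (closedTerm-fib q m) range) ⟩
  Σ< (suc (suc m)) (λ i → α * fibTerm q m i + β * prevFibTerm q m i)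
    ≡⟨ sumℤ-map-linear α β (fibTerm q m) (prevFibTerm q m) range ⟩
  α * Σ< (suc (suc m)) (fibTerm q m) + β * Σ< (suc (suc m)) (prevFibTerm q m)
    ≡⟨ cong₂ (λ s t → α * s + β * t) (fibPoly-extend q m 1) (Σ<-prevFibTerm q m) ⟩
  α * fibPoly q m + β * prevFibPoly q m ∎
  where
  α β : ℤ
  α = + 1 + q ^ 2
  β = + 2 * q ^ 2 - q ^ 4
  range : List ℕ
  range = upTo (suc (suc m))

closedForm-recurrent : ∀ q → Recurrent (q ^ 2) (λ n → closedForm q (suc n))
closedForm-recurrent q = recurrent-≗ {q ^ 2} (λ n → sym (closedForm-suc q n))
  (recurrent-linear {q ^ 2} (+ 1 + q ^ 2) (+ 2 * q ^ 2 - q ^ 4) {fibPoly q} {prevFibPoly q}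
    (fibPoly-recurrent q) (prevFibPoly-recurrent q))

closedForm-one : ∀ q → closedForm q 1 ≡ q ^ 2 + + 1
closedForm-one q = trans (closedForm-suc q 0) (evaluate (q ^ 2) (+ 2 * q ^ 2 - q ^ 4))
  where
  evaluate : ∀ x c → (+ 1 + x) * + 1 + c * + 0 ≡ x + + 1
  evaluate = solve-∀

closedForm-two : ∀ q → closedForm q 2 ≡ + 3 * q ^ 2
closedForm-two q = begin
  closedForm q 2
    ≡⟨ closedForm-suc q 1 ⟩
  (+ 1 + q ^ 2) * fibPoly q 1 + (+ 2 * q ^ 2 - q ^ 4) * + 1
    ≡⟨ cong₂ (λ s t → (+ 1 + q ^ 2) * s + (+ 2 * q ^ 2 - t) * + 1)
             (fibPoly-one q) (ℤ.^-distribˡ-+-* q 2 2) ⟩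
  (+ 1 + q ^ 2) * q ^ 2 + (+ 2 * q ^ 2 - q ^ 2 * q ^ 2) * + 1
    ≡⟨ evaluate (q ^ 2) ⟩
  + 3 * q ^ 2 ∎
  where
  evaluate : ∀ x → (+ 1 + x) * x + (+ 2 * x - x * x) * + 1 ≡ + 3 * x
  evaluate = solve-∀

theorem3p6 : (q : ℤ) →
    ((n : ℕ) → 3 ≤ n → d3 n q ≡ q ^ 2 * (d3 (n ∸ 1) q + d3 (n ∸ 2) q))
    × (d3 1 q ≡ q ^ 2 + + 1)
    × (d3 2 q ≡ + 3 * q ^ 2)
    × ((n : ℕ) → 1 ≤ n →
        d3 n q ≡ sumTo n (λ i →
          (+ 1 + q ^ 2) * q ^ (2 *ℕ (n ∸ 1 ∸ i)) * binomZ (+ n - + 1 - + i) i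
          + (+ 2 * q ^ 2 - q ^ 4) * q ^ (2 *ℕ (n ∸ 2 ∸ i)) * binomZ (+ n - + 2 - + i) i))
theorem3p6 q = recurrence , d3-one q , d3-two q , closed
  where
  recurrence : (n : ℕ) → 3 ≤ n → d3 n q ≡ q ^ 2 * (d3 (n ∸ 1) q + d3 (n ∸ 2) q)
  recurrence (suc (suc (suc n))) _                   = d3-recurrent q n
  recurrence (suc zero)          (s≤s ())
  recurrence (suc (suc zero))    (s≤s (s≤s ()))
  closed : (n : ℕ) → 1 ≤ n → d3 n q ≡ closedForm q n
  closed (suc n) _ =
    recurrent-unique {q ^ 2} {λ n → d3 (suc n) q} {λ n → closedForm q (suc n)}
      (d3-recurrent q) (closedForm-recurrent q)
      (trans (d3-one q) (sym (closedForm-one q)))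
      (trans (d3-two q) (sym (closedForm-two q))) n
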